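{- Let $n$ be a natural number and $L$ a list of natural numbers of length at most $n+1$. Let $P$ be a predicate on families with $P(\emptyset)$ true, and let $v_{[\,]}=\{\emptyset\}$ (the collection whose only member is the empty family). Let $Q$ be a predicate on pairs (family, set) that incrementally checks $P$ and is preserved by injective functions. Let $\Pi$ be a list containing all permutations of $[n]$, and let $\mathrm{upd}(\mathcal{F},L')=\mathrm{base}\bigl(\mathcal{F}\otimes_Q\mathcal{S}(n,|L'|-1),\Pi\bigr)$, where $|L'|$ is the length of $L'$. Then $\mathrm{enum\_rec}(L,v_{[\,]},\mathrm{upd})$ is an iso-base of $\mathcal{L}(L,n,P)$.
   Context: All sets and families are finite; sets are sets of natural numbers, $[n]=\{0,\ldots,n-1\}$, and a family $F$ is over $[n]$ if $\bigcup F\subseteq[n]$. For a list $L=[l_0,\ldots,l_m]$, $F$ is $L$-partitioned if every $A\in F$ has $|A|\le m$ and for each $0\le i\le m$ exactly $l_i$ members of $F$ have $i$ elements (for the empty list: $F=\emptyset$). $\mathcal{L}(L,n,P)$ is the collection of $L$-partitioned families over $[n]$ satisfying $P$. $\mathcal{S}(n,m)$ is the collection of $m$-element subsets of $[n]$. For a collection $\mathcal{F}$ and family $G$, $\mathcal{F}\otimes_Q G=\bigcup_{A\in G}\{F\cup\{A\}:F\in\mathcal{F},A\notin F,Q\,F\,A\}$. $Q$ incrementally checks $P$ if for every family $F$ and set $A$ with $|A|\ge|A'|$ for all $A'\in F$ and $A\notin F$: $P(F\cup\{A\})\iff(P(F)\text{ and } Q\,F\,A)$. $Q$ is preserved by injective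 functions if for all $F,A$ and $f$ injective on $\bigcup F\cup A$, $Q\,F\,A$ implies $Q\,\{f[B]:B\in F\}\,f[A]$. Families $F,F'$ are isomorphic if there is a bijection $f:\bigcup F\to\bigcup F'$ with $\{f[B]:B\in F\}=F'$. A collection $\mathcal{F}_b$ iso-represents $\mathcal{F}$ if each member of $\mathcal{F}$ is isomorphic to some member of $\mathcal{F}_b$; it is an iso-base of $\mathcal{F}$ if moreover no two distinct members of $\mathcal{F}_b$ are isomorphic. The function $\mathrm{base}(\mathcal{F},\Pi)$ (for a collection $\mathcal{F}$ of families over $[n]$ and a list $\Pi$ of permutations of $[n]$) is computed by sieving: repeatedly choose a member $F$ of the remaining collection, put it into the result, and remove from the remaining collection all families $\{\pi[B]:B\in F\}$ for $\pi\in\Pi$ (and $F$ itself), until the remaining collection is empty. For lists: $\mathrm{last}(L)$ is the last element, $\mathrm{butlast}(L)$ is $L$ without its last element, and $\mathrm{declast}(L)$ is $L$ with its last element decreased by one. The function $\mathrm{enum\_rec}$ is defined recursively by: $\mathrm{enum\_rec}(L,v,\mathrm{upd})=v$ if $L=[\,]$; $=\mathrm{enum\_rec}(\mathrm{butlast}(L),v,\mathrm{upd})$ if $L\ne[\,]$ and $\mathrm{last}(L)=0$; and $=\mathrm{upd}(\mathrm{enum\_rec}(\mathrm{declast}(L),v,\mathrm{upd}),L)$ otherwise. -}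

module Defs where

open import Data.Nat using (ℕ; zero; suc; _<_; _≤_; _<ᵇ_; _≡ᵇ_; _∸_; _≟_)
open import Data.Bool using (Bool; true; false; T; _∧_; _∨_)
open import Data.List using (List; []; _∷_; length; filter; last)
open import Data.List.Membership.Propositional using (_∈_)
open import Data.Maybe using (Maybe; just; nothing)
open import Data.Product using (Σ; ∃; ∃-syntax; _×_; _,_)
open import Data.Sum using (_⊎_)
open import Relation.Nullary using (¬_)
open import Relation.Binary.PropositionalEquality using (_≡_; _≢_)

-- Canonical finite sets: strictly increasing lists w.r.t. a strict order
-- (given as a boolean test).  Two finite sets are equal iff they have the
-- same members, so propositional equality _≡_ is set equality.

sortedᵇ : {A : Set} → (A → A → Bool) → List A → Bool
sortedᵇ lt []           = true
sortedᵇ lt (x ∷ [])     = true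
sortedᵇ lt (x ∷ y ∷ xs) = lt x y ∧ sortedᵇ lt (y ∷ xs)

record FinSet (A : Set) (lt : A → A → Bool) : Set where
  constructor mkFS
  field
    elems   : List A
    .sorted : T (sortedᵇ lt elems)
open FinSet public

NSet : Set
NSet = FinSet ℕ _<ᵇ_

lexᵇ : List ℕ → List ℕ → Bool
lexᵇ []       []       = false
lexᵇ []       (_ ∷ _)  = true
lexᵇ (_ ∷ _)  []       = false
lexᵇ (x ∷ xs) (y ∷ ys) = (x <ᵇ y) ∨ ((x ≡ᵇ y) ∧ lexᵇ xs ys)

NSet<ᵇ : NSet → NSet → Bool
NSet<ᵇ A B = lexᵇ (elems A) (elems B)

Family : Set
Family = FinSet NSet NSet<ᵇ

Collection : Set₁
Collection = Family → Set

_∈ₛ_ : ℕ → NSet → Set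
x ∈ₛ A = x ∈ elems A

_∈F_ : NSet → Family → Set
A ∈F F = A ∈ elems F

card : NSet → ℕ
card A = length (elems A)

∅F : Family
∅F = mkFS [] _

_∈⋃_ : ℕ → Family → Set
x ∈⋃ F = ∃[ A ] (A ∈F F × x ∈ₛ A)

IsInsert : NSet → Family → Family → Set
IsInsert A F X = ∀ B → (B ∈F X → (B ≡ A ⊎ B ∈F F)) × ((B ≡ A ⊎ B ∈F F) → B ∈F X)

IsImage : (ℕ → ℕ) → NSet → NSet → Set
IsImage f A B = ∀ y → (y ∈ₛ B → ∃[ x ] (x ∈ₛ A × f x ≡ y)) × (∃[ x ] (x ∈ₛ A × f x ≡ y) → y ∈ₛ B)

IsFamImage : (ℕ → ℕ) → Family → Family → Set
IsFamImage f F G = ∀ B → (B ∈F G → ∃[ B' ] (B' ∈F F × IsImage f B' B)) × (∃[ B' ] (B' ∈F F × IsImage f B' B) → B ∈F G)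

countCard : ℕ → Family → ℕ
countCard i F = length (filter (λ A → card A ≟ i) (elems F))

-- l_i (the i-th entry of L; only used for i < length L)
nth : List ℕ → ℕ → ℕ
nth []       _       = 0
nth (x ∷ xs) zero    = x
nth (x ∷ xs) (suc i) = nth xs i

Partitioned : List ℕ → Family → Set
Partitioned []          F = F ≡ ∅F
Partitioned L@(_ ∷ _)   F = (∀ A → A ∈F F → card A ≤ length L ∸ 1)
                          × (∀ i → i < length L → countCard i F ≡ nth L i)

OverSet : ℕ → NSet → Set
OverSet n A = ∀ x → x ∈ₛ A → x < n

Over : ℕ → Family → Set
Over n F = ∀ A → A ∈F F → OverSet n A

𝓛 : List ℕ → ℕ → (Family → Set) → Collection
𝓛 L n P F = Partitioned L F × Over n F × P F

𝓢 : ℕ → ℕ → NSet → Set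
𝓢 n m A = OverSet n A × card A ≡ m

_⊗⟨_⟩_ : Collection → (Family → NSet → Set) → (NSet → Set) → Collection
(𝓕 ⊗⟨ Q ⟩ G) X = ∃[ F ] ∃[ A ] (G A × 𝓕 F × ¬ (A ∈F F) × Q F A × IsInsert A F X)

IncChecks : (Family → NSet → Set) → (Family → Set) → Set
IncChecks Q P = ∀ F A → (∀ A' → A' ∈F F → card A' ≤ card A) → ¬ (A ∈F F) →
  ∀ X → IsInsert A F X → (P X → (P F × Q F A)) × ((P F × Q F A) → P X)

InjectiveOn : (ℕ → ℕ) → (ℕ → Set) → Set
InjectiveOn f D = ∀ x y → D x → D y → f x ≡ f y → x ≡ y

PreservedInj : (Family → NSet → Set) → Set
PreservedInj Q = ∀ F A (f : ℕ → ℕ) → InjectiveOn f (λ x → x ∈⋃ F ⊎ x ∈ₛ A) →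
  Q F A → ∀ F' A' → IsFamImage f F F' → IsImage f A A' → Q F' A'

Isomorphic : Family → Family → Set
Isomorphic F F' = ∃[ f ] ( (∀ x → x ∈⋃ F → f x ∈⋃ F')
                         × InjectiveOn f (λ x → x ∈⋃ F)
                         × (∀ y → y ∈⋃ F' → ∃[ x ] (x ∈⋃ F × f x ≡ y))
                         × IsFamImage f F F')

IsoRepresents : List Family → Collection → Set
IsoRepresents Fb 𝓕 = ∀ F → 𝓕 F → ∃[ G ] (G ∈ Fb × Isomorphic F G)

IsoBase : List Family → Collection → Set
IsoBase Fb 𝓕 = IsoRepresents Fb 𝓕
  × (∀ G G' → G ∈ Fb → G' ∈ Fb → G ≢ G' → ¬ Isomorphic G G')

IsPermOf : ℕ → (ℕ → ℕ) → Set
IsPermOf n π = (∀ x → x < n → π x < n)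
             × InjectiveOn π (λ x → x < n)
             × (∀ x → n ≤ x → π x ≡ x)

AllPerms : ℕ → List (ℕ → ℕ) → Set
AllPerms n Π = (∀ π → π ∈ Π → IsPermOf n π)
             × (∀ σ → IsPermOf n σ → ∃[ π ] (π ∈ Π × (∀ x → π x ≡ σ x)))

-- base(𝓕, Π) by sieving.  Since the member chosen at each step is
-- arbitrary, base is the relation "R is a possible result": every
-- possible sequence of choices is covered.

sieve : List (ℕ → ℕ) → Collection → Family → Collection
sieve Π C F X = C X × X ≢ F × (∀ π → π ∈ Π → ¬ IsFamImage π F X)

data Base (Π : List (ℕ → ℕ)) : Collection → List Family → Set₁ where
  base-done : ∀ {C} → (∀ X → ¬ C X) → Base Π C []
  base-step : ∀ {C F R} → C F → Base Π (sieve Π C F) R → Base Π C (F ∷ R)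

-- lists: last, butlast, declast; enum_rec (as the graph of the recursion,
-- with a relational update since base is relational)

butlast : List ℕ → List ℕ
butlast []           = []
butlast (x ∷ [])     = []
butlast (x ∷ y ∷ xs) = x ∷ butlast (y ∷ xs)

declast : List ℕ → List ℕ
declast []           = []
declast (x ∷ [])     = (x ∸ 1) ∷ []
declast (x ∷ y ∷ xs) = x ∷ declast (y ∷ xs)

data EnumRec (v : List Family) (Upd : List Family → List ℕ → List Family → Set₁)
             : List ℕ → List Family → Set₁ where
  er-nil  : EnumRec v Upd [] v
  er-zero : ∀ {L R} → last L ≡ just 0 → EnumRec v Upd (butlast L) R → EnumRec v Upd L R
  er-suc  : ∀ {L R R'} k → last L ≡ just (suc k) →
            EnumRec v Upd (declast L) R → Upd R L R' → EnumRec v Upd L R'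

upd : (Family → NSet → Set) → ℕ → List (ℕ → ℕ) → List Family → List ℕ → List Family → Set₁
upd Q n Π 𝓕 L' R = Base Π ((λ F → F ∈ 𝓕) ⊗⟨ Q ⟩ 𝓢 n (length L' ∸ 1)) R

v[] : List Family
v[] = ∅F ∷ []

{-# OPTIONS --safe #-}
-- A family X ∈ 𝓛(B ++ [k + 1], n, P) contains a set A of the
-- largest size |B|; removing it leaves X′ ∈ 𝓛(B ++ [k], n, P) with Q X′ A, because Q checks P
-- incrementally.  By induction X′ is isomorphic to some G in the previous result, and as both
-- live over [n] the isomorphism extends to a permutation π of [n].  Q is invariant under π, so
-- π[X] = G ∪ {π[A]} belongs to the product collection, and sieving that collection by all
-- permutations keeps exactly one member of each isomorphism class that occurs in it.
module Submission where

open import Defs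
open import Data.Bool using (Bool; T)
open import Data.Bool.Properties using (T-∧; T-∨)
open import Data.Empty using (⊥-elim)
open import Data.List using (List; []; _∷_; _++_; _∷ʳ_; length; filter; foldr; map; concat; last)
open import Data.List.Properties
  using (length-map; length-++; length-++-sucʳ; ≡-dec; filter-++; filter-accept; filter-reject; filter-none; filter-some)
open import Data.List.Membership.Propositional using (_∈_; _∉_; find; lose)
open import Data.List.Membership.Propositional.Properties
  using (∈-∃++; ∈-++⁺ˡ; ∈-++⁺ʳ; ∈-++⁻; ∈-map⁺; ∈-map⁻; ∈-concat⁺′; ∈-concat⁻′)
open import Data.List.Relation.Binary.Lex.Strict as Lex using (Lex-<; base; halt; this; next)
open import Data.List.Relation.Binary.Pointwise using (Pointwise-≡⇒≡; ≡⇒Pointwise-≡)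
open import Data.List.Relation.Unary.All as All using (All; []; _∷_)
open import Data.List.Relation.Unary.All.Properties using (++⁺; ++⁻ˡ; ++⁻ʳ; ¬Any⇒All¬)
open import Data.List.Relation.Unary.AllPairs as AllPairs using (AllPairs; []; _∷_)
open import Data.List.Relation.Unary.Any using (here; there; any?)
open import Data.List.Relation.Unary.Linked using (Linked; []; [-]; _∷_)
open import Data.List.Relation.Unary.Linked.Properties using (AllPairs⇒Linked; Linked⇒AllPairs)
open import Data.List.Relation.Unary.Unique.Propositional using (Unique)
import Data.List.Relation.Unary.Unique.Propositional.Properties as Unique
open import Data.Maybe using (just)
open import Data.Nat using (ℕ; zero; suc; _<_; _≤_; _∸_; _<ᵇ_; _≟_; _<?_; s≤s; s≤s⁻¹)
open import Data.Nat.Properties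
  using ( <ᵇ⇒<; <⇒<ᵇ; ≡ᵇ⇒≡; ≡⇒≡ᵇ; <-trans; <-cmp; <-resp₂-≡; <-≤-trans; <⇒≢; ≮⇒≥; n≮0; +-comm; suc-injective
        ; ≤-refl; <⇒≤; ≤∧≢⇒<)
open import Data.Product using (∃-syntax; _×_; _,_; proj₁; proj₂)
open import Data.Sum using (_⊎_; inj₁; inj₂; [_,_]′; map₂)
open import Data.Unit using (tt)
open import Function using (_∘_; _⇔_; mk⇔; Equivalence)
open import Function.Construct.Identity using (⇔-id)
open import Relation.Binary using (Rel; IsStrictTotalOrder; DecidableEquality; Tri; tri<; tri≈; tri>)
open import Relation.Binary.Structures.Biased using (isStrictTotalOrderᶜ)
open import Relation.Binary.PropositionalEquality
  using (_≡_; _≢_; refl; sym; trans; cong; subst; isEquivalence; module ≡-Reasoning)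
open import Relation.Nullary using (¬_; yes; no)
open import Relation.Nullary.Decidable using (T?; recompute; map′)
open import Relation.Unary using (Pred; Decidable)
open Equivalence using (to; from)

module _ {A : Set} where

  AllPairs-delete : ∀ {ℓ} {R : Rel A ℓ} xs {y ys} → AllPairs R (xs ++ y ∷ ys) → AllPairs R (xs ++ ys)
  AllPairs-delete []       (_ ∷ rs)  = rs
  AllPairs-delete (x ∷ xs) (rx ∷ rs) = ++⁺ (++⁻ˡ xs rx) (All.tail (++⁻ʳ xs rx)) ∷ AllPairs-delete xs rs

  ∈-++-∷⇔ : ∀ (xs : List A) {y ys z} → z ∈ xs ++ y ∷ ys ⇔ (z ≡ y ⊎ z ∈ xs ++ ys)
  ∈-++-∷⇔ xs {y} {ys} = mk⇔ split join
    where
      split : ∀ {z} → z ∈ xs ++ y ∷ ys → z ≡ y ⊎ z ∈ xs ++ ys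
      split z∈ with ∈-++⁻ xs z∈
      ... | inj₁ z∈xs         = inj₂ (∈-++⁺ˡ z∈xs)
      ... | inj₂ (here z≡y)   = inj₁ z≡y
      ... | inj₂ (there z∈ys) = inj₂ (∈-++⁺ʳ xs z∈ys)
      join : ∀ {z} → z ≡ y ⊎ z ∈ xs ++ ys → z ∈ xs ++ y ∷ ys
      join (inj₁ z≡y) = ∈-++⁺ʳ xs (here z≡y)
      join (inj₂ z∈)  = [ ∈-++⁺ˡ , (λ z∈ys → ∈-++⁺ʳ xs (there z∈ys)) ]′ (∈-++⁻ xs z∈)

  Unique[xs++y∷ys]⇒y∉xs++ys : ∀ (xs : List A) {y ys} → Unique (xs ++ y ∷ ys) → y ∉ xs ++ ys
  Unique[xs++y∷ys]⇒y∉xs++ys []       (y≢ys ∷ _) y∈ys        = All.lookup y≢ys y∈ys refl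
  Unique[xs++y∷ys]⇒y∉xs++ys (x ∷ xs) (x≢ ∷ _)   (here y≡x) = All.lookup x≢ (∈-++⁺ʳ xs (here refl)) (sym y≡x)
  Unique[xs++y∷ys]⇒y∉xs++ys (x ∷ xs) (_ ∷ u)    (there y∈) = Unique[xs++y∷ys]⇒y∉xs++ys xs u y∈

module _ {A : Set} {ℓ} {P : Pred A ℓ} (P? : Decidable P) where

  length-filter-++-∷-accept : ∀ xs {y ys} → P y →
    length (filter P? (xs ++ y ∷ ys)) ≡ suc (length (filter P? (xs ++ ys)))
  length-filter-++-∷-accept xs {y} {ys} Py = begin
    length (filter P? (xs ++ y ∷ ys))              ≡⟨ cong length (filter-++ P? xs (y ∷ ys)) ⟩
    length (filter P? xs ++ filter P? (y ∷ ys))    ≡⟨ cong (λ l → length (filter P? xs ++ l)) (filter-accept P? Py) ⟩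
    length (filter P? xs ++ y ∷ filter P? ys)      ≡⟨ length-++-sucʳ (filter P? xs) y (filter P? ys) ⟩
    suc (length (filter P? xs ++ filter P? ys))    ≡⟨ cong (suc ∘ length) (filter-++ P? xs ys) ⟨
    suc (length (filter P? (xs ++ ys)))            ∎
    where open ≡-Reasoning

  length-filter-++-∷-reject : ∀ xs {y ys} → ¬ P y →
    length (filter P? (xs ++ y ∷ ys)) ≡ length (filter P? (xs ++ ys))
  length-filter-++-∷-reject xs {y} {ys} ¬Py = begin
    length (filter P? (xs ++ y ∷ ys))              ≡⟨ cong length (filter-++ P? xs (y ∷ ys)) ⟩
    length (filter P? xs ++ filter P? (y ∷ ys))    ≡⟨ cong (λ l → length (filter P? xs ++ l)) (filter-reject P? ¬Py) ⟩
    length (filter P? xs ++ filter P? ys)          ≡⟨ cong length (filter-++ P? xs ys) ⟨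
    length (filter P? (xs ++ ys))                  ∎
    where open ≡-Reasoning

  length-filter≡suc⇒∃ : ∀ xs {k} → length (filter P? xs) ≡ suc k → ∃[ x ] (x ∈ xs × P x)
  length-filter≡suc⇒∃ xs eq with any? P? xs
  ... | yes some = find some
  ... | no none with () ← trans (sym (cong length (filter-none P? (¬Any⇒All¬ xs none)))) eq

  length-filter≡0⇒∉ : ∀ xs {x} → length (filter P? xs) ≡ 0 → x ∈ xs → ¬ P x
  length-filter≡0⇒∉ xs eq x∈xs Px = n≮0 (subst (0 <_) eq (filter-some P? (lose x∈xs Px)))

elems-injective : ∀ {A : Set} {lt : A → A → Bool} {X Y : FinSet A lt} → elems X ≡ elems Y → X ≡ Y
elems-injective {X = mkFS _ _} {mkFS _ _} refl = refl

module FinSets {A : Set} {lt : A → A → Bool}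
               (isSTO : IsStrictTotalOrder _≡_ (λ x y → T (lt x y))) where

  open IsStrictTotalOrder isSTO using (compare; irrefl; asym) renaming (_≟_ to _≟ₑ_; trans to ≺-trans)

  private
    _≺_ : A → A → Set
    x ≺ y = T (lt x y)

  Sorted : List A → Set
  Sorted = AllPairs _≺_

  private
    sortedᵇ⇒Linked : ∀ xs → T (sortedᵇ lt xs) → Linked _≺_ xs
    sortedᵇ⇒Linked []           _ = []
    sortedᵇ⇒Linked (x ∷ [])     _ = [-]
    sortedᵇ⇒Linked (x ∷ y ∷ xs) s =
      proj₁ (to T-∧ s) ∷ sortedᵇ⇒Linked (y ∷ xs) (proj₂ (to T-∧ s))

    Linked⇒sortedᵇ : ∀ {xs} → Linked _≺_ xs → T (sortedᵇ lt xs)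
    Linked⇒sortedᵇ []       = tt
    Linked⇒sortedᵇ [-]      = tt
    Linked⇒sortedᵇ (r ∷ rs) = from T-∧ (r , Linked⇒sortedᵇ rs)

  mkFinSet : (xs : List A) → Sorted xs → FinSet A lt
  mkFinSet xs s = mkFS xs (Linked⇒sortedᵇ (AllPairs⇒Linked s))

  elems-sorted : (X : FinSet A lt) → Sorted (elems X)
  elems-sorted (mkFS xs s) = Linked⇒AllPairs ≺-trans (sortedᵇ⇒Linked xs (recompute (T? _) s))

  elems-unique : (X : FinSet A lt) → Unique (elems X)
  elems-unique X = AllPairs.map (λ x≺y x≡y → irrefl x≡y x≺y) (elems-sorted X)

  _≟ₛ_ : DecidableEquality (FinSet A lt)
  X ≟ₛ Y = map′ elems-injective (cong elems) (≡-dec _≟ₑ_ (elems X) (elems Y))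

  private
    heads-equal : ∀ {x xs y ys} → All (x ≺_) xs → All (y ≺_) ys →
                  (∀ {z} → z ∈ x ∷ xs ⇔ z ∈ y ∷ ys) → x ≡ y
    heads-equal x≺xs y≺ys h with to h (here refl) | from h (here refl)
    ... | here x≡y   | _          = x≡y
    ... | there _    | here y≡x   = sym y≡x
    ... | there x∈ys | there y∈xs = ⊥-elim (asym (All.lookup x≺xs y∈xs) (All.lookup y≺ys x∈ys))

    drop-head : ∀ {x xs ys} → All (x ≺_) xs → (∀ {z} → z ∈ x ∷ xs → z ∈ x ∷ ys) →
                ∀ {z} → z ∈ xs → z ∈ ys
    drop-head x≺xs h z∈xs with h (there z∈xs)
    ... | here refl  = ⊥-elim (irrefl refl (All.lookup x≺xs z∈xs))
    ... | there z∈ys = z∈ys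

  Sorted-ext : ∀ {xs ys} → Sorted xs → Sorted ys → (∀ {z} → z ∈ xs ⇔ z ∈ ys) → xs ≡ ys
  Sorted-ext []      []      h = refl
  Sorted-ext []      (_ ∷ _) h with from h (here refl)
  ... | ()
  Sorted-ext (_ ∷ _) []      h with to h (here refl)
  ... | ()
  Sorted-ext {x ∷ xs} (x≺xs ∷ sxs) (y≺ys ∷ sys) h with heads-equal x≺xs y≺ys h
  ... | refl = cong (x ∷_) (Sorted-ext sxs sys (mk⇔ (drop-head x≺xs (to h)) (drop-head y≺ys (from h))))

  ext : ∀ {X Y : FinSet A lt} → (∀ {z} → z ∈ elems X ⇔ z ∈ elems Y) → X ≡ Y
  ext {X} {Y} h = elems-injective (Sorted-ext (elems-sorted X) (elems-sorted Y) h)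

  insertSorted : A → List A → List A
  insertSorted x []       = x ∷ []
  insertSorted x (y ∷ ys) with compare x y
  ... | tri< _ _ _ = x ∷ y ∷ ys
  ... | tri≈ _ _ _ = y ∷ ys
  ... | tri> _ _ _ = y ∷ insertSorted x ys

  ∈-insertSorted⁻ : ∀ {z} x ys → z ∈ insertSorted x ys → z ≡ x ⊎ z ∈ ys
  ∈-insertSorted⁻ x []       (here z≡x) = inj₁ z≡x
  ∈-insertSorted⁻ x (y ∷ ys) z∈ with compare x y | z∈
  ... | tri< _ _ _ | here z≡x = inj₁ z≡x
  ... | tri< _ _ _ | there z∈ = inj₂ z∈
  ... | tri≈ _ _ _ | z∈ys     = inj₂ z∈ys
  ... | tri> _ _ _ | here z≡y = inj₂ (here z≡y)
  ... | tri> _ _ _ | there z∈ = map₂ there (∈-insertSorted⁻ x ys z∈)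

  ∈-insertSorted⁺ : ∀ {z} x ys → z ≡ x ⊎ z ∈ ys → z ∈ insertSorted x ys
  ∈-insertSorted⁺ x []       (inj₁ z≡x) = here z≡x
  ∈-insertSorted⁺ x (y ∷ ys) z∈ with compare x y | z∈
  ... | tri< _ _ _   | inj₁ z≡x         = here z≡x
  ... | tri< _ _ _   | inj₂ z∈ys        = there z∈ys
  ... | tri≈ _ x≡y _ | inj₁ z≡x         = here (trans z≡x x≡y)
  ... | tri≈ _ _ _   | inj₂ z∈ys        = z∈ys
  ... | tri> _ _ _   | inj₁ z≡x         = there (∈-insertSorted⁺ x ys (inj₁ z≡x))
  ... | tri> _ _ _   | inj₂ (here z≡y)  = here z≡y
  ... | tri> _ _ _   | inj₂ (there z∈)  = there (∈-insertSorted⁺ x ys (inj₂ z∈))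

  insertSorted-sorted : ∀ x {ys} → Sorted ys → Sorted (insertSorted x ys)
  insertSorted-sorted x {[]}     _             = [] ∷ []
  insertSorted-sorted x {y ∷ ys} (y≺ys ∷ sys) with compare x y
  ... | tri< x≺y _ _ = (x≺y ∷ All.map (≺-trans x≺y) y≺ys) ∷ y≺ys ∷ sys
  ... | tri≈ _ _ _   = y≺ys ∷ sys
  ... | tri> _ _ y≺x = All.tabulate y≺new ∷ insertSorted-sorted x sys
    where
      y≺new : ∀ {z} → z ∈ insertSorted x ys → y ≺ z
      y≺new z∈ = [ (λ z≡x → subst (y ≺_) (sym z≡x) y≺x) , All.lookup y≺ys ]′ (∈-insertSorted⁻ x ys z∈)

  length-insertSorted : ∀ {x} ys → x ∉ ys → length (insertSorted x ys) ≡ suc (length ys)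
  length-insertSorted []            _   = refl
  length-insertSorted {x} (y ∷ ys) x∉ with compare x y
  ... | tri< _ _ _   = refl
  ... | tri≈ _ x≡y _ = ⊥-elim (x∉ (here x≡y))
  ... | tri> _ _ _   = cong suc (length-insertSorted ys (x∉ ∘ there))

  fromList : List A → FinSet A lt
  fromList xs = mkFinSet (foldr insertSorted [] xs) (sorted-foldr xs)
    where
      sorted-foldr : ∀ xs → Sorted (foldr insertSorted [] xs)
      sorted-foldr []       = []
      sorted-foldr (x ∷ xs) = insertSorted-sorted x (sorted-foldr xs)

  ∈-fromList : ∀ {z} xs → z ∈ elems (fromList xs) ⇔ z ∈ xs
  ∈-fromList []       = mk⇔ (λ ()) (λ ())
  ∈-fromList (x ∷ xs) = mk⇔
    (λ z∈ → [ here , there ∘ to (∈-fromList xs) ]′ (∈-insertSorted⁻ x (elems (fromList xs)) z∈))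
    (λ { (here z≡x) → ∈-insertSorted⁺ x (elems (fromList xs)) (inj₁ z≡x)
       ; (there z∈) → ∈-insertSorted⁺ x (elems (fromList xs)) (inj₂ (from (∈-fromList xs) z∈)) })

  length-fromList : ∀ {xs} → Unique xs → length (elems (fromList xs)) ≡ length xs
  length-fromList {[]}     []           = refl
  length-fromList {x ∷ xs} (x≢xs ∷ u) =
    trans (length-insertSorted _ (λ x∈ → All.lookup x≢xs (to (∈-fromList xs) x∈) refl))
          (cong suc (length-fromList u))

  insert : A → FinSet A lt → FinSet A lt
  insert x X = fromList (x ∷ elems X)

  ∈-insert : ∀ {z} x X → z ∈ elems (insert x X) ⇔ (z ≡ x ⊎ z ∈ elems X)
  ∈-insert x X = mk⇔
    (λ z∈ → case-∷ (to (∈-fromList (x ∷ elems X)) z∈))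
    (from (∈-fromList (x ∷ elems X)) ∘ [ here , there ]′)
    where
      case-∷ : ∀ {z xs} → z ∈ x ∷ xs → z ≡ x ⊎ z ∈ xs
      case-∷ (here z≡x) = inj₁ z≡x
      case-∷ (there z∈) = inj₂ z∈

  image : (A → A) → FinSet A lt → FinSet A lt
  image h X = fromList (map h (elems X))

  ∈-image : ∀ {z} h X → z ∈ elems (image h X) ⇔ (∃[ x ] (x ∈ elems X × h x ≡ z))
  ∈-image h X = mk⇔
    (λ z∈ → let x , x∈ , z≡hx = ∈-map⁻ h (to (∈-fromList (map h (elems X))) z∈) in x , x∈ , sym z≡hx)
    (λ { (x , x∈ , refl) → from (∈-fromList (map h (elems X))) (∈-map⁺ h x∈) })

  length-image : ∀ {h} → (∀ {x y} → h x ≡ h y → x ≡ y) → ∀ X → length (elems (image h X)) ≡ length (elems X)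
  length-image {h} h-inj X = trans (length-fromList (Unique.map⁺ h-inj (elems-unique X))) (length-map h (elems X))

  image-injective : ∀ {h} → (∀ {x y} → h x ≡ h y → x ≡ y) → ∀ {X Y} → image h X ≡ image h Y → X ≡ Y
  image-injective {h} h-inj {X} {Y} hX≡hY = ext (mk⇔ (transfer {X} {Y} hX≡hY) (transfer {Y} {X} (sym hX≡hY)))
    where
      transfer : ∀ {X Y} → image h X ≡ image h Y → ∀ {z} → z ∈ elems X → z ∈ elems Y
      transfer {X} {Y} hX≡hY {z} z∈X =
        let x , x∈Y , hx≡hz = to (∈-image h Y)
                                (subst (λ Z → h z ∈ elems Z) hX≡hY (from (∈-image h X) (z , z∈X , refl)))
        in subst (_∈ elems Y) (h-inj hx≡hz) x∈Y

  image-cong : ∀ {g h} X → (∀ x → x ∈ elems X → g x ≡ h x) → image g X ≡ image h X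
  image-cong {g} {h} X g≗h = ext (mk⇔
    (λ z∈ → let x , x∈ , gx≡z = to (∈-image g X) z∈
            in from (∈-image h X) (x , x∈ , trans (sym (g≗h x x∈)) gx≡z))
    (λ z∈ → let x , x∈ , hx≡z = to (∈-image h X) z∈
            in from (∈-image g X) (x , x∈ , trans (g≗h x x∈) hx≡z)))

  image-identity : ∀ {h} X → (∀ x → x ∈ elems X → h x ≡ x) → image h X ≡ X
  image-identity {h} X h≗id = ext (mk⇔
    (λ z∈ → let x , x∈ , hx≡z = to (∈-image h X) z∈ in subst (_∈ elems X) (trans (sym (h≗id x x∈)) hx≡z) x∈)
    (λ z∈ → from (∈-image h X) (_ , z∈ , h≗id _ z∈)))

  image-∘ : ∀ g h X → image g (image h X) ≡ image (g ∘ h) X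
  image-∘ g h X = ext (mk⇔
    (λ z∈ → let y , y∈ , gy≡z = to (∈-image g (image h X)) z∈
                x , x∈ , hx≡y = to (∈-image h X) y∈
            in from (∈-image (g ∘ h) X) (x , x∈ , trans (cong g hx≡y) gy≡z))
    (λ z∈ → let x , x∈ , ghx≡z = to (∈-image (g ∘ h) X) z∈
            in from (∈-image g (image h X)) (h x , from (∈-image h X) (x , x∈ , refl) , ghx≡z)))

  image-insert : ∀ h x X → image h (insert x X) ≡ insert (h x) (image h X)
  image-insert h x X = ext (mk⇔ image⊆insert insert⊆image)
    where
      image⊆insert : ∀ {z} → z ∈ elems (image h (insert x X)) → z ∈ elems (insert (h x) (image h X))
      image⊆insert z∈ with to (∈-image h (insert x X)) z∈
      ... | y , y∈ , hy≡z = from (∈-insert (h x) (image h X)) (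
        [ (λ y≡x → inj₁ (trans (sym hy≡z) (cong h y≡x)))
        , (λ y∈X → inj₂ (from (∈-image h X) (y , y∈X , hy≡z))) ]′ (to (∈-insert x X) y∈))
      insert⊆image : ∀ {z} → z ∈ elems (insert (h x) (image h X)) → z ∈ elems (image h (insert x X))
      insert⊆image z∈ with to (∈-insert (h x) (image h X)) z∈
      ... | inj₁ z≡hx = from (∈-image h (insert x X)) (x , from (∈-insert x X) (inj₁ refl) , sym z≡hx)
      ... | inj₂ z∈hX = let y , y∈X , hy≡z = to (∈-image h X) z∈hX
                        in from (∈-image h (insert x X)) (y , from (∈-insert x X) (inj₂ y∈X) , hy≡z)

  delete : ∀ {x} (X : FinSet A lt) → x ∈ elems X → FinSet A lt
  delete X x∈X with pre , post , elems≡ ← ∈-∃++ x∈X =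
    mkFinSet (pre ++ post) (AllPairs-delete pre (subst Sorted elems≡ (elems-sorted X)))

  ∈-delete : ∀ {x z} X (x∈X : x ∈ elems X) → z ∈ elems X ⇔ (z ≡ x ⊎ z ∈ elems (delete X x∈X))
  ∈-delete X x∈X with pre , post , elems≡ ← ∈-∃++ x∈X rewrite elems≡ = ∈-++-∷⇔ pre

  ∉-delete : ∀ {x} X (x∈X : x ∈ elems X) → x ∉ elems (delete X x∈X)
  ∉-delete X x∈X with pre , post , elems≡ ← ∈-∃++ x∈X =
    Unique[xs++y∷ys]⇒y∉xs++ys pre (subst Unique elems≡ (elems-unique X))

  module _ {ℓ} {P : Pred A ℓ} (P? : Decidable P) {x} (X : FinSet A lt) (x∈X : x ∈ elems X) where

    length-filter-delete-accept : P x →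
      length (filter P? (elems X)) ≡ suc (length (filter P? (elems (delete X x∈X))))
    length-filter-delete-accept Px with pre , post , elems≡ ← ∈-∃++ x∈X rewrite elems≡ =
      length-filter-++-∷-accept P? pre Px

    length-filter-delete-reject : ¬ P x →
      length (filter P? (elems X)) ≡ length (filter P? (elems (delete X x∈X)))
    length-filter-delete-reject ¬Px with pre , post , elems≡ ← ∈-∃++ x∈X rewrite elems≡ =
      length-filter-++-∷-reject P? pre ¬Px

Tri-map : ∀ {a b c a′ b′ c′} {A : Set a} {B : Set b} {C : Set c} {A′ : Set a′} {B′ : Set b′} {C′ : Set c′} →
          A ⇔ A′ → B ⇔ B′ → C ⇔ C′ → Tri A B C → Tri A′ B′ C′
Tri-map A⇔ B⇔ C⇔ (tri< a ¬b ¬c) = tri< (to A⇔ a) (¬b ∘ from B⇔) (¬c ∘ from C⇔)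
Tri-map A⇔ B⇔ C⇔ (tri≈ ¬a b ¬c) = tri≈ (¬a ∘ from A⇔) (to B⇔ b) (¬c ∘ from C⇔)
Tri-map A⇔ B⇔ C⇔ (tri> ¬a ¬b c) = tri> (¬a ∘ from A⇔) (¬b ∘ from B⇔) (to C⇔ c)

<⇔<ᵇ : ∀ m n → m < n ⇔ T (m <ᵇ n)
<⇔<ᵇ m n = mk⇔ <⇒<ᵇ (<ᵇ⇒< m n)

<ᵇ-isStrictTotalOrder : IsStrictTotalOrder _≡_ (λ m n → T (m <ᵇ n))
<ᵇ-isStrictTotalOrder = isStrictTotalOrderᶜ record
  { isEquivalence = isEquivalence
  ; trans         = λ {m} {n} {o} m<n n<o → <⇒<ᵇ (<-trans (<ᵇ⇒< m n m<n) (<ᵇ⇒< n o n<o))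
  ; compare       = λ m n → Tri-map (<⇔<ᵇ m n) (⇔-id _) (<⇔<ᵇ n m) (<-cmp m n)
  }

Lex-<⇔lexᵇ : ∀ xs ys → Lex-< _≡_ _<_ xs ys ⇔ T (lexᵇ xs ys)
Lex-<⇔lexᵇ xs ys = mk⇔ Lex-<⇒lexᵇ (lexᵇ⇒Lex-< xs ys)
  where
    Lex-<⇒lexᵇ : ∀ {xs ys} → Lex-< _≡_ _<_ xs ys → T (lexᵇ xs ys)
    Lex-<⇒lexᵇ (base ())
    Lex-<⇒lexᵇ halt                    = tt
    Lex-<⇒lexᵇ (this x<y)              = from T-∨ (inj₁ (<⇒<ᵇ x<y))
    Lex-<⇒lexᵇ {x ∷ _} (next refl xs<ys) = from T-∨ (inj₂ (from T-∧ (≡⇒≡ᵇ x x refl , Lex-<⇒lexᵇ xs<ys)))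

    lexᵇ⇒Lex-< : ∀ xs ys → T (lexᵇ xs ys) → Lex-< _≡_ _<_ xs ys
    lexᵇ⇒Lex-< []       (_ ∷ _)  _ = halt
    lexᵇ⇒Lex-< (x ∷ xs) (y ∷ ys) t with to T-∨ t
    ... | inj₁ x<ᵇy  = this (<ᵇ⇒< x y x<ᵇy)
    ... | inj₂ x≡ᵇy∧xs<ys = let x≡ᵇy , xs<ys = to T-∧ x≡ᵇy∧xs<ys
                           in next (≡ᵇ⇒≡ x y x≡ᵇy) (lexᵇ⇒Lex-< xs ys xs<ys)

NSet<ᵇ-isStrictTotalOrder : IsStrictTotalOrder _≡_ (λ A B → T (NSet<ᵇ A B))
NSet<ᵇ-isStrictTotalOrder = isStrictTotalOrderᶜ record
  { isEquivalence = isEquivalence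
  ; trans         = λ {A} {B} {C} A<B B<C → to (Lex-<⇔lexᵇ (elems A) (elems C))
      (Lex.<-transitive isEquivalence <-resp₂-≡ <-trans
        (from (Lex-<⇔lexᵇ (elems A) (elems B)) A<B) (from (Lex-<⇔lexᵇ (elems B) (elems C)) B<C))
  ; compare       = λ A B → Tri-map (Lex-<⇔lexᵇ (elems A) (elems B))
      (mk⇔ (λ xs≋ys → elems-injective (Pointwise-≡⇒≡ xs≋ys)) (≡⇒Pointwise-≡ ∘ cong elems))
      (Lex-<⇔lexᵇ (elems B) (elems A))
      (Lex.<-compare sym <-cmp (elems A) (elems B))
  }

module ℕSet = FinSets <ᵇ-isStrictTotalOrder
module FamSet = FinSets NSet<ᵇ-isStrictTotalOrder

image : (ℕ → ℕ) → NSet → NSet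
image = ℕSet.image

famImage : (ℕ → ℕ) → Family → Family
famImage f = FamSet.image (image f)

image-IsImage : ∀ f A → IsImage f A (image f A)
image-IsImage f A y = to (ℕSet.∈-image f A) , from (ℕSet.∈-image f A)

IsImage⇒≡image : ∀ f A B → IsImage f A B → B ≡ image f A
IsImage⇒≡image f A B i = ℕSet.ext λ {y} →
  mk⇔ (from (ℕSet.∈-image f A) ∘ proj₁ (i y)) (proj₂ (i y) ∘ to (ℕSet.∈-image f A))

famImage-IsFamImage : ∀ f F → IsFamImage f F (famImage f F)
famImage-IsFamImage f F B =
  (λ B∈ → let B′ , B′∈ , fB′≡B = to (FamSet.∈-image (image f) F) B∈
          in B′ , B′∈ , subst (IsImage f B′) fB′≡B (image-IsImage f B′))
  , λ { (B′ , B′∈ , i) → from (FamSet.∈-image (image f) F) (B′ , B′∈ , sym (IsImage⇒≡image f B′ B i)) }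

IsFamImage⇒≡famImage : ∀ f F G → IsFamImage f F G → G ≡ famImage f F
IsFamImage⇒≡famImage f F G i = FamSet.ext λ {B} → mk⇔
  (λ B∈ → let B′ , B′∈ , iB′ = proj₁ (i B) B∈
          in from (FamSet.∈-image (image f) F) (B′ , B′∈ , sym (IsImage⇒≡image f B′ B iB′)))
  (λ B∈ → let B′ , B′∈ , fB′≡B = to (FamSet.∈-image (image f) F) B∈
          in proj₂ (i B) (B′ , B′∈ , subst (IsImage f B′) fB′≡B (image-IsImage f B′)))

famImage≡⇒IsFamImage : ∀ f F {G} → famImage f F ≡ G → IsFamImage f F G
famImage≡⇒IsFamImage f F refl = famImage-IsFamImage f F

∈⋃-famImage⁺ : ∀ f F {x} → x ∈⋃ F → f x ∈⋃ famImage f F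
∈⋃-famImage⁺ f F (B , B∈ , x∈) =
  image f B , from (FamSet.∈-image (image f) F) (B , B∈ , refl) , from (ℕSet.∈-image f B) (_ , x∈ , refl)

∈⋃-famImage⁻ : ∀ f F {y} → y ∈⋃ famImage f F → ∃[ x ] (x ∈⋃ F × f x ≡ y)
∈⋃-famImage⁻ f F (B′ , B′∈ , y∈) with to (FamSet.∈-image (image f) F) B′∈
... | B , B∈ , refl = let x , x∈ , fx≡y = to (ℕSet.∈-image f B) y∈ in x , (B , B∈ , x∈) , fx≡y

famImage-cong : ∀ {f g} F → (∀ x → x ∈⋃ F → f x ≡ g x) → famImage f F ≡ famImage g F
famImage-cong F f≗g = FamSet.image-cong F λ B B∈ → ℕSet.image-cong B λ x x∈ → f≗g x (B , B∈ , x∈)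

famImage-identity : ∀ {f} F → (∀ x → x ∈⋃ F → f x ≡ x) → famImage f F ≡ F
famImage-identity F f≗id = FamSet.image-identity F λ B B∈ → ℕSet.image-identity B λ x x∈ → f≗id x (B , B∈ , x∈)

famImage-∘ : ∀ g f F → famImage g (famImage f F) ≡ famImage (g ∘ f) F
famImage-∘ g f F = trans (FamSet.image-∘ (image g) (image f) F) (FamSet.image-cong F λ B _ → ℕSet.image-∘ g f B)

Isomorphic-famImage : ∀ {f} F → InjectiveOn f (_∈⋃ F) → Isomorphic F (famImage f F)
Isomorphic-famImage {f} F f-inj =
  f , (λ _ → ∈⋃-famImage⁺ f F) , f-inj , (λ _ → ∈⋃-famImage⁻ f F) , famImage-IsFamImage f F

Isomorphic-refl : ∀ F → Isomorphic F F
Isomorphic-refl F = subst (Isomorphic F) (famImage-identity F λ _ _ → refl) (Isomorphic-famImage F λ _ _ _ _ x≡y → x≡y)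

Isomorphic-trans : ∀ {F G H} → Isomorphic F G → Isomorphic G H → Isomorphic F H
Isomorphic-trans {F} {G} {H} (f , f-into , f-inj , _ , fF≡G) (g , _ , g-inj , _ , gG≡H) =
  subst (Isomorphic F) H≡ (Isomorphic-famImage F g∘f-inj)
  where
    g∘f-inj : InjectiveOn (g ∘ f) (_∈⋃ F)
    g∘f-inj x y x∈ y∈ = f-inj x y x∈ y∈ ∘ g-inj (f x) (f y) (f-into x x∈) (f-into y y∈)
    H≡ : famImage (g ∘ f) F ≡ H
    H≡ = sym (trans (IsFamImage⇒≡famImage g G H gG≡H)
                    (trans (cong (famImage g) (IsFamImage⇒≡famImage f F G fF≡G)) (famImage-∘ g f F)))

⋃-list : Family → List ℕ
⋃-list F = concat (map elems (elems F))

∈⋃⇔∈⋃-list : ∀ {x} F → x ∈⋃ F ⇔ x ∈ ⋃-list F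
∈⋃⇔∈⋃-list F = mk⇔
  (λ { (B , B∈ , x∈) → ∈-concat⁺′ x∈ (∈-map⁺ elems B∈) })
  (λ x∈ → let xs , x∈xs , xs∈ = ∈-concat⁻′ (map elems (elems F)) x∈
              B , B∈ , xs≡B = ∈-map⁻ elems xs∈
          in B , B∈ , subst (_ ∈_) xs≡B x∈xs)

invertOn : (ℕ → ℕ) → List ℕ → ℕ → ℕ
invertOn f []       y = y
invertOn f (x ∷ xs) y with f x ≟ y
... | yes _ = x
... | no  _ = invertOn f xs y

invertOn-inverse : ∀ {f} xs → InjectiveOn f (_∈ xs) → ∀ {x} → x ∈ xs → invertOn f xs (f x) ≡ x
invertOn-inverse {f} (z ∷ xs) f-inj {x} x∈ with f z ≟ f x | x∈
... | yes fz≡fx | _          = f-inj z x (here refl) x∈ fz≡fx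
... | no  fz≢fx | here refl  = ⊥-elim (fz≢fx refl)
... | no  _     | there x∈xs = invertOn-inverse xs (λ a b a∈ b∈ → f-inj a b (there a∈) (there b∈)) x∈xs

Isomorphic-sym : ∀ {F G} → Isomorphic F G → Isomorphic G F
Isomorphic-sym {F} {G} (f , _ , f-inj , f-onto , fF≡G) = subst (Isomorphic G) gG≡F (Isomorphic-famImage G g-inj)
  where
    g : ℕ → ℕ
    g = invertOn f (⋃-list F)
    g∘f≗id : ∀ x → x ∈⋃ F → g (f x) ≡ x
    g∘f≗id x x∈ = invertOn-inverse (⋃-list F)
      (λ a b a∈ b∈ → f-inj a b (from (∈⋃⇔∈⋃-list F) a∈) (from (∈⋃⇔∈⋃-list F) b∈))
      (to (∈⋃⇔∈⋃-list F) x∈)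
    g-inj : InjectiveOn g (_∈⋃ G)
    g-inj y y′ y∈ y′∈ gy≡gy′ with f-onto y y∈ | f-onto y′ y′∈
    ... | x , x∈ , refl | x′ , x′∈ , refl =
      cong f (trans (sym (g∘f≗id x x∈)) (trans gy≡gy′ (g∘f≗id x′ x′∈)))
    gG≡F : famImage g G ≡ F
    gG≡F = begin
      famImage g G              ≡⟨ cong (famImage g) (IsFamImage⇒≡famImage f F G fF≡G) ⟩
      famImage g (famImage f F) ≡⟨ famImage-∘ g f F ⟩
      famImage (g ∘ f) F        ≡⟨ famImage-identity F g∘f≗id ⟩
      F                         ∎
      where open ≡-Reasoning

insert-IsInsert : ∀ A F → IsInsert A F (FamSet.insert A F)
insert-IsInsert A F B = to (FamSet.∈-insert A F) , from (FamSet.∈-insert A F)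

delete-IsInsert : ∀ {A} X (A∈X : A ∈F X) → IsInsert A (FamSet.delete X A∈X) X
delete-IsInsert X A∈X B = to (FamSet.∈-delete X A∈X) , from (FamSet.∈-delete X A∈X)

IsInsert⇒≡insert : ∀ {A F X} → IsInsert A F X → X ≡ FamSet.insert A F
IsInsert⇒≡insert {A} {F} X≡A∪F = FamSet.ext λ {B} → mk⇔
  (from (FamSet.∈-insert A F) ∘ proj₁ (X≡A∪F B)) (proj₂ (X≡A∪F B) ∘ to (FamSet.∈-insert A F))

swap : ℕ → ℕ → ℕ → ℕ
swap a b x with x ≟ a
... | yes _ = b
... | no  _ with x ≟ b
...   | yes _ = a
...   | no  _ = x

swap-left : ∀ a b → swap a b a ≡ b
swap-left a b with a ≟ a
... | yes _   = refl
... | no  a≢a = ⊥-elim (a≢a refl)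

swap-right : ∀ a b → swap a b b ≡ a
swap-right a b with b ≟ a
... | yes b≡a = b≡a
... | no  _ with b ≟ b
...   | yes _   = refl
...   | no  b≢b = ⊥-elim (b≢b refl)

swap-other : ∀ {a b x} → x ≢ a → x ≢ b → swap a b x ≡ x
swap-other {a} {b} {x} x≢a x≢b with x ≟ a
... | yes x≡a = ⊥-elim (x≢a x≡a)
... | no  _ with x ≟ b
...   | yes x≡b = ⊥-elim (x≢b x≡b)
...   | no  _   = refl

swap-involutive : ∀ a b x → swap a b (swap a b x) ≡ x
swap-involutive a b x with x ≟ a
... | yes refl = swap-right x b
... | no  x≢a with x ≟ b
...   | yes refl = swap-left a x
...   | no  x≢b  = swap-other x≢a x≢b

swap-injective : ∀ a b {x y} → swap a b x ≡ swap a b y → x ≡ y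
swap-injective a b {x} {y} eq = trans (sym (swap-involutive a b x)) (trans (cong (swap a b) eq) (swap-involutive a b y))

swap-< : ∀ {n a b} x → a < n → b < n → x < n → swap a b x < n
swap-< {a = a} {b} x a<n b<n x<n with x ≟ a
... | yes _ = b<n
... | no  _ with x ≟ b
...   | yes _ = a<n
...   | no  _ = x<n

IsPermOf-injective : ∀ {n π} → IsPermOf n π → ∀ {x y} → π x ≡ π y → x ≡ y
IsPermOf-injective {n} {π} (π<n , π-inj , π-fix) {x} {y} πx≡πy with x <? n | y <? n
... | yes x<n | yes y<n = π-inj x y x<n y<n πx≡πy
... | yes x<n | no  y≮n = ⊥-elim (y≮n (subst (_< n) (trans πx≡πy (π-fix y (≮⇒≥ y≮n))) (π<n x x<n)))
... | no  x≮n | yes y<n = ⊥-elim (x≮n (subst (_< n) (trans (sym πx≡πy) (π-fix x (≮⇒≥ x≮n))) (π<n y y<n)))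
... | no  x≮n | no  y≮n = trans (sym (π-fix x (≮⇒≥ x≮n))) (trans πx≡πy (π-fix y (≮⇒≥ y≮n)))

IsPermOf-id : ∀ n → IsPermOf n (λ x → x)
IsPermOf-id n = (λ _ x<n → x<n) , (λ _ _ _ _ x≡y → x≡y) , (λ _ _ → refl)

IsPermOf-swap∘ : ∀ {n τ a b} → a < n → b < n → IsPermOf n τ → IsPermOf n (swap a b ∘ τ)
IsPermOf-swap∘ {n} {τ} {a} {b} a<n b<n τ-perm@(τ<n , _ , τ-fix) =
    (λ x x<n → swap-< (τ x) a<n b<n (τ<n x x<n))
  , (λ x y _ _ → IsPermOf-injective τ-perm ∘ swap-injective a b)
  , λ x n≤x → trans (cong (swap a b) (τ-fix x n≤x)) (swap-other (≢-below a<n n≤x) (≢-below b<n n≤x))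
  where
    ≢-below : ∀ {c x} → c < n → n ≤ x → x ≢ c
    ≢-below c<n n≤x x≡c = <⇒≢ (<-≤-trans c<n n≤x) (sym x≡c)

extend-to-perm : ∀ {n} f (D : List ℕ) → (∀ x → x ∈ D → x < n) → (∀ x → x ∈ D → f x < n) →
                 InjectiveOn f (_∈ D) → ∃[ σ ] (IsPermOf n σ × (∀ x → x ∈ D → σ x ≡ f x))
extend-to-perm {n} f []      _      _       _     = (λ x → x) , IsPermOf-id n , λ _ ()
extend-to-perm {n} f (d ∷ D) D<n fD<n f-inj
  with τ , τ-perm , τ≗f ← extend-to-perm f D (λ x → D<n x ∘ there) (λ x → fD<n x ∘ there)
                                          (λ x y x∈ y∈ → f-inj x y (there x∈) (there y∈))
  = swap (τ d) (f d) ∘ τ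
  , IsPermOf-swap∘ (proj₁ τ-perm d (D<n d (here refl))) (fD<n d (here refl)) τ-perm
  , agrees
  where
    agrees : ∀ x → x ∈ d ∷ D → swap (τ d) (f d) (τ x) ≡ f x
    agrees x x∈ with x ≟ d | x∈
    ... | yes refl | _         = swap-left (τ d) (f d)
    ... | no  x≢d  | here x≡d  = ⊥-elim (x≢d x≡d)
    ... | no  x≢d  | there x∈D = trans
      (swap-other (x≢d ∘ IsPermOf-injective τ-perm)
                  (λ τx≡fd → x≢d (f-inj x d x∈ (here refl) (trans (sym (τ≗f x x∈D)) τx≡fd))))
      (τ≗f x x∈D)

⋃-bounded : ∀ {n x} F → Over n F → x ∈⋃ F → x < n
⋃-bounded F F⊆n (B , B∈ , x∈B) = F⊆n B B∈ _ x∈B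

Isomorphic⇒IsPermOf : ∀ {n F G} → Over n F → Over n G → Isomorphic F G →
                      ∃[ σ ] (IsPermOf n σ × famImage σ F ≡ G)
Isomorphic⇒IsPermOf {n} {F} {G} F⊆n G⊆n (f , f-into , f-inj , _ , fF≡G) =
  let σ , σ-perm , σ≗f = extend-to-perm f (⋃-list F)
        (λ _ → ⋃-bounded F F⊆n ∘ ∈⋃) (λ x → ⋃-bounded G G⊆n ∘ f-into x ∘ ∈⋃)
        (λ x y x∈ y∈ → f-inj x y (∈⋃ x∈) (∈⋃ y∈))
  in σ , σ-perm , trans (famImage-cong F λ x x∈ → σ≗f x (to (∈⋃⇔∈⋃-list F) x∈))
                        (sym (IsFamImage⇒≡famImage f F G fF≡G))
  where
    ∈⋃ : ∀ {x} → x ∈ ⋃-list F → x ∈⋃ F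
    ∈⋃ = from (∈⋃⇔∈⋃-list F)

Isomorphic⇒perm∈Π : ∀ {n Π} F G → AllPerms n Π → Over n F → Over n G → Isomorphic F G →
                      ∃[ π ] (π ∈ Π × famImage π F ≡ G)
Isomorphic⇒perm∈Π F G (_ , Π-complete) F⊆n G⊆n F≅G =
  let σ , σ-perm , σF≡G = Isomorphic⇒IsPermOf {F = F} {G} F⊆n G⊆n F≅G
      π , π∈Π , π≗σ     = Π-complete σ σ-perm
  in π , π∈Π , trans (famImage-cong F λ x _ → π≗σ x) σF≡G

Base-⊆ : ∀ {Π C R F} → Base Π C R → F ∈ R → C F
Base-⊆ (base-step CF _) (here refl) = CF
Base-⊆ (base-step _ b)  (there F∈)  = proj₁ (Base-⊆ b F∈)

Base-covers : ∀ {Π C R X} → Base Π C R → C X →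
              ∃[ F ] (F ∈ R × (X ≡ F ⊎ ∃[ π ] (π ∈ Π × famImage π F ≡ X)))
Base-covers (base-done empty) CX = ⊥-elim (empty _ CX)
Base-covers {Π} {X = X} (base-step {F = F} _ b) CX
  with X FamSet.≟ₛ F | any? (λ π → famImage π F FamSet.≟ₛ X) Π
... | yes X≡F | _        = F , here refl , inj₁ X≡F
... | no _    | yes some = F , here refl , inj₂ (find some)
... | no X≢F  | no none  =
  let G , G∈ , covered = Base-covers b
        (CX , X≢F , λ π π∈ πF≡X → none (lose π∈ (sym (IsFamImage⇒≡famImage π F X πF≡X))))
  in G , there G∈ , covered

-- Of two members of R, the later one survived the sieve of the earlier one.
Base-sieved : ∀ {Π C R G G′} → Base Π C R → G ∈ R → G′ ∈ R → G ≢ G′ →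
              (∀ π → π ∈ Π → famImage π G ≢ G′) ⊎ (∀ π → π ∈ Π → famImage π G′ ≢ G)
Base-sieved (base-step _ _) (here refl) (here refl)  G≢G′ = ⊥-elim (G≢G′ refl)
Base-sieved {G = G} (base-step _ b) (here refl) (there G′∈) _ =
  inj₁ λ π π∈ πG≡G′ → proj₂ (proj₂ (Base-⊆ b G′∈)) π π∈ (famImage≡⇒IsFamImage π G πG≡G′)
Base-sieved {G′ = G′} (base-step _ b) (there G∈) (here refl) _ =
  inj₂ λ π π∈ πG′≡G → proj₂ (proj₂ (Base-⊆ b G∈)) π π∈ (famImage≡⇒IsFamImage π G′ πG′≡G)
Base-sieved (base-step _ b) (there G∈)  (there G′∈) G≢G′ = Base-sieved b G∈ G′∈ G≢G′

Base-IsoBase : ∀ {n Π C R} → AllPerms n Π → (∀ X → C X → Over n X) → Base Π C R → IsoBase R C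
Base-IsoBase {n} {Π} {C} {R} Π-perms C-over b = represents , separated
  where
    over : ∀ {G} → G ∈ R → Over n G
    over G∈ = C-over _ (Base-⊆ b G∈)

    represents : IsoRepresents R C
    represents X CX with Base-covers b CX
    ... | F , F∈ , inj₁ refl              = F , F∈ , Isomorphic-refl F
    ... | F , F∈ , inj₂ (π , π∈ , refl) =
      F , F∈ , Isomorphic-sym {F} {famImage π F}
                 (Isomorphic-famImage F λ _ _ _ _ → IsPermOf-injective (proj₁ Π-perms π π∈))

    separated : ∀ G G′ → G ∈ R → G′ ∈ R → G ≢ G′ → ¬ Isomorphic G G′
    separated G G′ G∈ G′∈ G≢G′ G≅G′ with Base-sieved b G∈ G′∈ G≢G′
    ... | inj₁ no-π = let π , π∈ , πG≡G′ = Isomorphic⇒perm∈Π G G′ Π-perms (over G∈) (over G′∈) G≅G′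
                      in no-π π π∈ πG≡G′
    ... | inj₂ no-π = let π , π∈ , πG′≡G = Isomorphic⇒perm∈Π G′ G Π-perms (over G′∈) (over G∈)
                                             (Isomorphic-sym {G} {G′} G≅G′)
                      in no-π π π∈ πG′≡G

IsoBase-≅ : ∀ {R 𝓕 𝓖} → IsoBase R 𝓕 → (∀ X → 𝓖 X → ∃[ Y ] (𝓕 Y × Isomorphic X Y)) → IsoBase R 𝓖
IsoBase-≅ {R} {𝓕} {𝓖} (represents , separated) 𝓖≅𝓕 = represents′ , separated
  where
    represents′ : IsoRepresents R 𝓖
    represents′ X 𝓖X =
      let Y , 𝓕Y , X≅Y = 𝓖≅𝓕 X 𝓖X
          F , F∈R , Y≅F = represents Y 𝓕Y
      in F , F∈R , Isomorphic-trans {X} {Y} {F} X≅Y Y≅F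

butlast-∷ʳ-last : ∀ L {x} → last L ≡ just x → L ≡ butlast L ∷ʳ x
butlast-∷ʳ-last (y ∷ [])     refl    = refl
butlast-∷ʳ-last (y ∷ z ∷ zs) last≡x = cong (y ∷_) (butlast-∷ʳ-last (z ∷ zs) last≡x)

declast-∷ʳ-last : ∀ L {x} → last L ≡ just x → declast L ≡ butlast L ∷ʳ (x ∸ 1)
declast-∷ʳ-last (y ∷ [])     refl    = refl
declast-∷ʳ-last (y ∷ z ∷ zs) last≡x = cong (y ∷_) (declast-∷ʳ-last (z ∷ zs) last≡x)

length-∷ʳ : ∀ (L : List ℕ) x → length (L ∷ʳ x) ≡ suc (length L)
length-∷ʳ L x = trans (length-++ L) (+-comm (length L) 1)

nth-∷ʳ-< : ∀ L x {i} → i < length L → nth (L ∷ʳ x) i ≡ nth L i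
nth-∷ʳ-< (l ∷ L) x {zero}  _       = refl
nth-∷ʳ-< (l ∷ L) x {suc i} (s≤s i<) = nth-∷ʳ-< L x i<

nth-∷ʳ-length : ∀ L x → nth (L ∷ʳ x) (length L) ≡ x
nth-∷ʳ-length []      x = refl
nth-∷ʳ-length (l ∷ L) x = nth-∷ʳ-length L x

-- Partitioned without the special case for L = [] and without truncated subtraction.
Partition : List ℕ → Family → Set
Partition L F = (∀ A → A ∈F F → card A < length L) × (∀ i → i < length L → countCard i F ≡ nth L i)

Partitioned⇔Partition : ∀ L F → Partitioned L F ⇔ Partition L F
Partitioned⇔Partition []      F = mk⇔ (λ { refl → (λ _ ()) , (λ _ ()) })
  (λ (small , _) → FamSet.ext (mk⇔ (λ A∈ → ⊥-elim (n≮0 (small _ A∈))) λ ()))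
Partitioned⇔Partition (_ ∷ _) F = mk⇔ (λ (small , counts) → (λ A A∈ → s≤s (small A A∈)) , counts)
                                      (λ (small , counts) → (λ A A∈ → s≤s⁻¹ (small A A∈)) , counts)

<-length-∷ʳ : ∀ (B : List ℕ) x {i} → i ≤ length B → i < length (B ∷ʳ x)
<-length-∷ʳ B x i≤ = subst (_ <_) (sym (length-∷ʳ B x)) (s≤s i≤)

<-length-∷ʳ⁻¹ : ∀ (B : List ℕ) x {i} → i < length (B ∷ʳ x) → i ≤ length B
<-length-∷ʳ⁻¹ B x i< = s≤s⁻¹ (subst (_ <_) (length-∷ʳ B x) i<)

countCard-last : ∀ B x X → Partition (B ∷ʳ x) X → countCard (length B) X ≡ x
countCard-last B x X (_ , counts) = trans (counts (length B) (<-length-∷ʳ B x ≤-refl)) (nth-∷ʳ-length B x)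

Partition-∷ʳ-zero : ∀ B X → Partition (B ∷ʳ 0) X → Partition B X
Partition-∷ʳ-zero B X p@(small , counts) = small′ , counts′
  where
    small′ : ∀ A → A ∈F X → card A < length B
    small′ A A∈ = ≤∧≢⇒< (<-length-∷ʳ⁻¹ B 0 (small A A∈))
      (length-filter≡0⇒∉ (λ A → card A ≟ length B) (elems X) (countCard-last B 0 X p) A∈)
    counts′ : ∀ i → i < length B → countCard i X ≡ nth B i
    counts′ i i< = trans (counts i (<-length-∷ʳ B 0 (<⇒≤ i<))) (nth-∷ʳ-< B 0 i<)

Partition-∷ʳ-suc⇒∃ : ∀ B k X → Partition (B ∷ʳ suc k) X → ∃[ A ] (A ∈F X × card A ≡ length B)
Partition-∷ʳ-suc⇒∃ B k X p = length-filter≡suc⇒∃ (λ A → card A ≟ length B) (elems X) (countCard-last B (suc k) X p)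

Partition-∷ʳ-suc : ∀ B k X {A} (A∈X : A ∈F X) → card A ≡ length B →
                   Partition (B ∷ʳ suc k) X → Partition (B ∷ʳ k) (FamSet.delete X A∈X)
Partition-∷ʳ-suc B k X {A} A∈X |A|≡ p@(small , counts) = small′ , counts′
  where
    X′ : Family
    X′ = FamSet.delete X A∈X

    small′ : ∀ A′ → A′ ∈F X′ → card A′ < length (B ∷ʳ k)
    small′ A′ A′∈ =
      <-length-∷ʳ B k (<-length-∷ʳ⁻¹ B (suc k) (small A′ (from (FamSet.∈-delete X A∈X) (inj₂ A′∈))))

    counts′ : ∀ i → i < length (B ∷ʳ k) → countCard i X′ ≡ nth (B ∷ʳ k) i
    counts′ i i< with i ≟ length B
    ... | yes refl = suc-injective (begin
      suc (countCard i X′) ≡⟨ FamSet.length-filter-delete-accept (λ A → card A ≟ i) X A∈X |A|≡ ⟨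
      countCard i X       ≡⟨ countCard-last B (suc k) X p ⟩
      suc k               ≡⟨ cong suc (nth-∷ʳ-length B k) ⟨
      suc (nth (B ∷ʳ k) i) ∎)
      where open ≡-Reasoning
    ... | no i≢ = begin
      countCard i X′          ≡⟨ FamSet.length-filter-delete-reject (λ A → card A ≟ i) X A∈X
                                   (λ |A|≡i → i≢ (trans (sym |A|≡i) |A|≡)) ⟨
      countCard i X           ≡⟨ counts i (<-length-∷ʳ B (suc k) (<⇒≤ i<B)) ⟩
      nth (B ∷ʳ suc k) i      ≡⟨ nth-∷ʳ-< B (suc k) i<B ⟩
      nth B i                 ≡⟨ nth-∷ʳ-< B k i<B ⟨
      nth (B ∷ʳ k) i          ∎
      where
        open ≡-Reasoning
        i<B : i < length B
        i<B = ≤∧≢⇒< (<-length-∷ʳ⁻¹ B k i<) i≢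

𝓛-∷ʳ-zero : ∀ B n P X → 𝓛 (B ∷ʳ 0) n P X → 𝓛 B n P X
𝓛-∷ʳ-zero B n P X (X-part , X-over , PX) =
  from (Partitioned⇔Partition B X) (Partition-∷ʳ-zero B X (to (Partitioned⇔Partition (B ∷ʳ 0) X) X-part)) , X-over , PX

v[]-IsoBase : ∀ n P → IsoBase v[] (𝓛 [] n P)
v[]-IsoBase n P = (λ { X (refl , _) → ∅F , here refl , Isomorphic-refl ∅F })
                , λ { G G′ (here refl) (here refl) G≢G′ _ → G≢G′ refl }

module Enumeration (n : ℕ) (P : Family → Set) (Q : Family → NSet → Set)
                   (Q-checks-P : IncChecks Q P) (Q-preserved : PreservedInj Q)
                   (Π : List (ℕ → ℕ)) (Π-perms : AllPerms n Π) where

  Extensions : List Family → ℕ → Collection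
  Extensions R m = (_∈ R) ⊗⟨ Q ⟩ 𝓢 n m

  Extensions-over : ∀ {R m} → All (Over n) R → ∀ X → Extensions R m X → Over n X
  Extensions-over R-over X (F , A , (A-over , _) , F∈R , _ , _ , X≡A∪F) B B∈X with proj₁ (X≡A∪F B) B∈X
  ... | inj₁ refl = A-over
  ... | inj₂ B∈F  = All.lookup R-over F∈R B B∈F

  -- Move A along the permutation π carrying X′ to G: then π[X] = G ∪ {π[A]}.
  insert-≅-Extensions : ∀ {R m X′ A X G} → All (Over n) R → Over n X′ → G ∈ R → Isomorphic X′ G →
                       𝓢 n m A → ¬ (A ∈F X′) → Q X′ A → IsInsert A X′ X →
                       ∃[ Y ] (Extensions R m Y × Isomorphic X Y)
  insert-≅-Extensions {R} {m} {X′} {A} {X} {G} R-over X′-over G∈R X′≅G (A-over , |A|≡m) A∉X′ QX′A X≡A∪X′ =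
    FamSet.insert A′ G , (G , A′ , 𝓢A′ , G∈R , A′∉G , QGA′ , insert-IsInsert A′ G) , X≅Y
    where
      π∃ : ∃[ π ] (π ∈ Π × famImage π X′ ≡ G)
      π∃ = Isomorphic⇒perm∈Π X′ G Π-perms X′-over (All.lookup R-over G∈R) X′≅G
      π : ℕ → ℕ
      π = proj₁ π∃
      πX′≡G : famImage π X′ ≡ G
      πX′≡G = proj₂ (proj₂ π∃)
      π-perm : IsPermOf n π
      π-perm = proj₁ Π-perms π (proj₁ (proj₂ π∃))
      π-inj : ∀ {x y} → π x ≡ π y → x ≡ y
      π-inj = IsPermOf-injective π-perm
      A′ : NSet
      A′ = image π A
      𝓢A′ : 𝓢 n m A′
      𝓢A′ = (λ y y∈ → let x , x∈A , πx≡y = to (ℕSet.∈-image π A) y∈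
                      in subst (_< n) πx≡y (proj₁ π-perm x (A-over x x∈A)))
          , trans (ℕSet.length-image π-inj A) |A|≡m
      A′∉G : ¬ (A′ ∈F G)
      A′∉G A′∈G = let B , B∈X′ , πB≡A′ = to (FamSet.∈-image (image π) X′) (subst (A′ ∈F_) (sym πX′≡G) A′∈G)
                  in A∉X′ (subst (_∈F X′) (ℕSet.image-injective π-inj πB≡A′) B∈X′)
      QGA′ : Q G A′
      QGA′ = Q-preserved X′ A π (λ _ _ _ _ → π-inj) QX′A G A′
               (famImage≡⇒IsFamImage π X′ πX′≡G) (image-IsImage π A)
      πX≡Y : famImage π X ≡ FamSet.insert A′ G
      πX≡Y = begin
        famImage π X                          ≡⟨ cong (famImage π) (IsInsert⇒≡insert {A} {X′} {X} X≡A∪X′) ⟩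
        famImage π (FamSet.insert A X′)       ≡⟨ FamSet.image-insert (image π) A X′ ⟩
        FamSet.insert A′ (famImage π X′)      ≡⟨ cong (FamSet.insert A′) πX′≡G ⟩
        FamSet.insert A′ G                    ∎
        where open ≡-Reasoning
      X≅Y : Isomorphic X (FamSet.insert A′ G)
      X≅Y = subst (Isomorphic X) πX≡Y (Isomorphic-famImage X λ _ _ _ _ → π-inj)

  -- A has the largest size in X, so X = X′ ∪ {A} is one incremental step and Q checks P there.
  𝓛-∷ʳ-suc-delete : ∀ B k X {A} (A∈X : A ∈F X) → card A ≡ length B → 𝓛 (B ∷ʳ suc k) n P X →
                    𝓛 (B ∷ʳ k) n P (FamSet.delete X A∈X) × Q (FamSet.delete X A∈X) A
  𝓛-∷ʳ-suc-delete B k X {A} A∈X |A|≡ (X-part , X-over , PX) =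
    ( (from (Partitioned⇔Partition (B ∷ʳ k) X′) (Partition-∷ʳ-suc B k X A∈X |A|≡ part) , X′-over , proj₁ PQ)
    , proj₂ PQ )
    where
      X′ : Family
      X′ = FamSet.delete X A∈X
      part : Partition (B ∷ʳ suc k) X
      part = to (Partitioned⇔Partition (B ∷ʳ suc k) X) X-part
      X′⊆X : ∀ {B′} → B′ ∈F X′ → B′ ∈F X
      X′⊆X B′∈ = from (FamSet.∈-delete X A∈X) (inj₂ B′∈)
      X′-over : Over n X′
      X′-over B′ = X-over B′ ∘ X′⊆X
      A-largest : ∀ A′ → A′ ∈F X′ → card A′ ≤ card A
      A-largest A′ A′∈ = subst (card A′ ≤_) (sym |A|≡) (<-length-∷ʳ⁻¹ B (suc k) (proj₁ part A′ (X′⊆X A′∈)))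
      PQ : P X′ × Q X′ A
      PQ = proj₁ (Q-checks-P X′ A A-largest (FamSet.∉-delete X A∈X) X (delete-IsInsert X A∈X)) PX

  𝓛-∷ʳ-suc-≅-Extensions : ∀ {R} B k → All (Over n) R → IsoRepresents R (𝓛 (B ∷ʳ k) n P) →
                         ∀ X → 𝓛 (B ∷ʳ suc k) n P X → ∃[ Y ] (Extensions R (length B) Y × Isomorphic X Y)
  𝓛-∷ʳ-suc-≅-Extensions {R} B k R-over R-represents X X∈𝓛@(X-part , X-over , _) =
    insert-≅-Extensions {m = length B} {X′} {A} {X} {G}
      R-over X′-over G∈R X′≅G (X-over A A∈X , |A|≡) (FamSet.∉-delete X A∈X) QX′A (delete-IsInsert X A∈X)
    where
      A∃ : ∃[ A ] (A ∈F X × card A ≡ length B)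
      A∃ = Partition-∷ʳ-suc⇒∃ B k X (to (Partitioned⇔Partition (B ∷ʳ suc k) X) X-part)
      A : NSet
      A = proj₁ A∃
      A∈X : A ∈F X
      A∈X = proj₁ (proj₂ A∃)
      |A|≡ : card A ≡ length B
      |A|≡ = proj₂ (proj₂ A∃)
      X′ : Family
      X′ = FamSet.delete X A∈X
      X′∈𝓛×QX′A : 𝓛 (B ∷ʳ k) n P X′ × Q X′ A
      X′∈𝓛×QX′A = 𝓛-∷ʳ-suc-delete B k X A∈X |A|≡ X∈𝓛
      X′-over : Over n X′
      X′-over = proj₁ (proj₂ (proj₁ X′∈𝓛×QX′A))
      QX′A : Q X′ A
      QX′A = proj₂ X′∈𝓛×QX′A
      G∃ : ∃[ G ] (G ∈ R × Isomorphic X′ G)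
      G∃ = R-represents X′ (proj₁ X′∈𝓛×QX′A)
      G : Family
      G = proj₁ G∃
      G∈R : G ∈ R
      G∈R = proj₁ (proj₂ G∃)
      X′≅G : Isomorphic X′ G
      X′≅G = proj₂ (proj₂ G∃)

  enumeration-IsoBase : ∀ {L R} → EnumRec v[] (upd Q n Π) L R → All (Over n) R × IsoBase R (𝓛 L n P)
  enumeration-IsoBase er-nil = ((λ _ ()) ∷ []) , v[]-IsoBase n P
  enumeration-IsoBase (er-zero {L} {R} last≡0 rec) =
    proj₁ IH , IsoBase-≅ (proj₂ IH) λ X X∈𝓛 →
      X , 𝓛-∷ʳ-zero (butlast L) n P X (subst (λ L′ → 𝓛 L′ n P X) (butlast-∷ʳ-last L last≡0) X∈𝓛)
        , Isomorphic-refl X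
    where
      IH : All (Over n) R × IsoBase R (𝓛 (butlast L) n P)
      IH = enumeration-IsoBase rec
  enumeration-IsoBase (er-suc {L} {R} {R′} k last≡ rec up) =
    All.tabulate (λ {G} G∈ → Extensions-over R-over G (Base-⊆ up′ G∈))
    , IsoBase-≅ (Base-IsoBase Π-perms (Extensions-over R-over) up′) λ X X∈𝓛 →
        𝓛-∷ʳ-suc-≅-Extensions B k R-over R-represents′ X (subst (λ L′ → 𝓛 L′ n P X) L≡ X∈𝓛)
    where
      B : List ℕ
      B = butlast L
      L≡ : L ≡ B ∷ʳ suc k
      L≡ = butlast-∷ʳ-last L last≡
      IH : All (Over n) R × IsoBase R (𝓛 (declast L) n P)
      IH = enumeration-IsoBase rec
      R-over : All (Over n) R
      R-over = proj₁ IH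
      R-represents′ : IsoRepresents R (𝓛 (B ∷ʳ k) n P)
      R-represents′ = subst (λ L′ → IsoRepresents R (𝓛 L′ n P)) (declast-∷ʳ-last L last≡) (proj₁ (proj₂ IH))
      up′ : Base Π (Extensions R (length B)) R′
      up′ = subst (λ m → Base Π (Extensions R m) R′)
                  (trans (cong (λ L′ → length L′ ∸ 1) L≡) (cong (_∸ 1) (length-∷ʳ B (suc k)))) up

theorem5 : (n : ℕ) (L : List ℕ) → length L ≤ suc n →
    (P : Family → Set) → P ∅F →
    (Q : Family → NSet → Set) → IncChecks Q P → PreservedInj Q →
    (Π : List (ℕ → ℕ)) → AllPerms n Π →
    (R : List Family) → EnumRec v[] (upd Q n Π) L R →
    IsoBase R (𝓛 L n P)
theorem5 n L _ P _ Q Q-checks-P Q-preserved Π Π-perms R enum =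
  proj₂ (Enumeration.enumeration-IsoBase n P Q Q-checks-P Q-preserved Π Π-perms enum)
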